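{- Let $n\ge1$, let $\lambda$ be a partition with at most $n$ parts, and let $\mathfrak{S}^\Gamma_{\lambda,t}$ be the six-vertex system described in the context. Then \[\Big[\prod_{1\le j<i\le n}(t z_j+z_i)\Big]\,Z(\mathfrak{S}^\Gamma_{\lambda,t})\] is symmetric under all permutations of $z_1,\dots,z_n$.
   Context: Let $N=n+\lambda_1$ and let $\lambda+\rho$ denote the set $\{\lambda_k+n-k+1:1\le k\le n\}$. Parameters: $z_1,\dots,z_n$, $\alpha_1,\alpha_2,\dots$, $t$. The system $\mathfrak{S}^\Gamma_{\lambda,t}$ is a rectangular grid with $n$ rows numbered $1,\dots,n$ from top to bottom and $N$ columns numbered $1,\dots,N$ from right to left; vertex $(i,j)$ lies in row $i$, column $j$. Each vertex has four edges (left, top, right, bottom); neighbouring vertices share edges, and there are left/right boundary edges at the two ends of each row and top/bottom boundary edges at the two ends of each column. A state assigns $\pm$ to every edge with: all left and bottom boundary edges $+$, all right boundary edges $-$, top boundary edge of column $j$ equal to $-$ iff $j\in\lambda+\rho$. Vertex weights at $(i,j)$ for spins (left, top, right, bottom): $(+,+,+,+)$: $1$; $(-,-,-,-)$: $z_i-t\alpha_j$; $(+,-,+,-)$: $t$; $(-,+,-,+)$: $z_i+\alpha_j$; $(-,+,+,-)$: $z_i(t+1)$; $(+,-,-,+)$: $1$; otherwise $0$. A state's weight is the product of vertex weights; $Z(\mathfrak{S}^\Gamma_{\lambda,t})$ is the sum of weights over all states. -}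

module Defs where

open import Level using (Level)
open import Data.Bool using (Bool; true; false; if_then_else_; _∧_; _∨_)
open import Data.Nat using (ℕ; zero; suc; _∸_; _≡ᵇ_; _<ᵇ_)
import Data.Nat as ℕ
open import Data.Fin using (Fin; toℕ; fromℕ; inject₁)
import Data.Fin as Fin
open import Data.List using (List; []; _∷_; map; concatMap; allFin; foldr)
open import Data.Bool.ListAction using (any; all)
open import Data.Vec using (Vec; lookup; head)
open import Algebra.Bundles using (CommutativeRing)

data Spin : Set where
  plus minus : Spin

allFuns : {A : Set} → List A → (k : ℕ) → List (Fin k → A)
allFuns xs zero = (λ ()) ∷ []
allFuns xs (suc k) =
  concatMap (λ a → map (λ f → λ { Fin.zero → a ; (Fin.suc i) → f i }) (allFuns xs k)) xs

spins : List Spin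
spins = plus ∷ minus ∷ []

isPlus isMinus : Spin → Bool
isPlus plus = true
isPlus minus = false
isMinus plus = false
isMinus minus = true

-- partition with at most n parts: weakly decreasing vector of length n (trailing zeros allowed)
IsPartition : {n : ℕ} → Vec ℕ n → Set
IsPartition {n} lam = (i j : Fin n) → i Fin.≤ j → lookup lam j ℕ.≤ lookup lam i

firstPart : {n : ℕ} → Vec ℕ n → ℕ
firstPart {zero} lam = 0
firstPart {suc n} lam = head lam

numCols : {n : ℕ} → Vec ℕ n → ℕ
numCols {n} lam = n ℕ.+ firstPart lam

-- membership of a (1-based) column index c in λ+ρ = {λ_k + n - k + 1 : 1 ≤ k ≤ n}
-- with 0-based k' = k - 1 the element is λ_{k'} + n - k'
inLamRho : {n : ℕ} → Vec ℕ n → ℕ → Bool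
inLamRho {n} lam c = any (λ k → (lookup lam k ℕ.+ (n ∸ toℕ k)) ≡ᵇ c) (allFin n)

-- A state: horizontal spins h i e for row i (0-based, top to bottom) and
-- horizontal edge e ∈ {0..N}: edge e lies to the right of column e+1 and to the left of
-- column e (columns 1-based, numbered right to left); e = 0 is the right boundary,
-- e = N the left boundary.
-- Vertical spins v r j for column j (0-based, i.e. column j+1) and vertical edge r ∈ {0..n}:
-- edge r lies above row r+1 and below row r; r = 0 top boundary, r = n bottom boundary.
module SixVertex {c ℓ : Level} (R : CommutativeRing c ℓ) where
  open CommutativeRing R

  sumR : {A : Set} → List A → (A → Carrier) → Carrier
  sumR xs f = foldr (λ a acc → f a + acc) 0# xs

  prodR : {A : Set} → List A → (A → Carrier) → Carrier
  prodR xs f = foldr (λ a acc → f a * acc) 1# xs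

  -- vertex weight at (row with parameter zi, column with parameter aj),
  -- spins (left, top, right, bottom)
  vweight : (t zi aj : Carrier) → Spin → Spin → Spin → Spin → Carrier
  vweight t zi aj plus  plus  plus  plus  = 1#
  vweight t zi aj minus minus minus minus = zi + - (t * aj)
  vweight t zi aj plus  minus plus  minus = t
  vweight t zi aj minus plus  minus plus  = zi + aj
  vweight t zi aj minus plus  plus  minus = zi * (t + 1#)
  vweight t zi aj plus  minus minus plus  = 1#
  vweight t zi aj _     _     _     _     = 0#

  module _ {n : ℕ} (lam : Vec ℕ n) where
    N : ℕ
    N = numCols lam

    HState : Set
    HState = Fin n → Fin (suc N) → Spin

    VState : Set
    VState = Fin (suc n) → Fin N → Spin

    boundaryOK : HState → VState → Bool
    boundaryOK h v =
      all (λ i → isPlus (h i (fromℕ N)) ∧ isMinus (h i Fin.zero)) (allFin n)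
      ∧ all (λ j → isPlus (v (fromℕ n) j)
            ∧ (if inLamRho lam (suc (toℕ j)) then isMinus (v Fin.zero j) else isPlus (v Fin.zero j)))
          (allFin N)

    -- weight of a state; z i is z_{i+1}, α (j+1) is the parameter of column j+1
    stateWeight : (t : Carrier) (α : ℕ → Carrier) (z : Fin n → Carrier) → HState → VState → Carrier
    stateWeight t α z h v =
      prodR (allFin n) λ i → prodR (allFin N) λ j →
        vweight t (z i) (α (suc (toℕ j)))
          (h i (Fin.suc j)) (v (inject₁ i) j) (h i (inject₁ j)) (v (Fin.suc i) j)

    Z : (t : Carrier) (α : ℕ → Carrier) (z : Fin n → Carrier) → Carrier
    Z t α z =
      sumR (allFuns (allFuns spins (suc N)) n) λ h →
      sumR (allFuns (allFuns spins N) (suc n)) λ v →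
        if boundaryOK h v then stateWeight t α z h v else 0#

  deltaFactor : {n : ℕ} (t : Carrier) (z : Fin n → Carrier) → Carrier
  deltaFactor {n} t z =
    prodR (allFin n) λ i → prodR (allFin n) λ j →
      if toℕ j <ᵇ toℕ i then t * z j + z i else 1#

module Submission where

open import Defs
open import Level using (Level)
open import Data.Nat using (ℕ; _≤_)
open import Data.Fin using (Fin)
open import Data.Vec using (Vec)
open import Data.Fin.Permutation using (Permutation′; _⟨$⟩ʳ_)
open import Algebra.Bundles using (CommutativeRing)

open import Algebra.Bundles using (RawRing; CommutativeMonoid)
open import Algebra.Solver.Ring.AlmostCommutativeRing using (fromCommutativeRing; _-Raw-AlmostCommutative⟶_)
import Algebra.Solver.Ring as RingSolver
import Tactic.RingSolver.Core.AlmostCommutativeRing as Almost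
import Tactic.RingSolver.NonReflective as NonReflective
open import Data.Bool using (Bool; true; false; T; if_then_else_; _∧_)
open import Data.Bool.ListAction using (all; and)
open import Data.Bool.Properties using (T-∧; ∧-assoc; ∧-comm; ∧-commutativeMonoid)
open import Data.Fin using (zero; suc; toℕ; fromℕ; inject₁)
open import Data.Fin.Permutation using (_⟨$⟩ˡ_; inverseˡ; inverseʳ)
open import Data.List using (List; []; _∷_; _++_; [_]; map; concatMap; foldr; allFin; tabulate)
open import Data.List.Membership.Propositional using (_∈_)
open import Data.List.Membership.Propositional.Properties using (∈-allFin; ∈-tabulate⁺)
open import Data.List.Membership.Propositional.Properties.WithK using (unique∧set⇒bag)
open import Data.List.Properties using (++-assoc; map-tabulate)
open import Data.List.Relation.Binary.BagAndSetEquality using (∼bag⇒↭)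
open import Data.List.Relation.Binary.Permutation.Propositional using (_↭_)
import Data.List.Relation.Binary.Permutation.Propositional as ↭
open import Data.List.Relation.Binary.Permutation.Propositional.Properties using (map⁺)
open import Data.List.Relation.Unary.Unique.Propositional.Properties using (tabulate⁺; allFin⁺)
open import Data.Maybe using (Maybe; just; nothing; is-just)
import Data.Maybe as Maybe
open import Data.Nat using (zero; suc)
import Data.Nat as ℕ
import Data.Nat.Properties as ℕ
open import Data.Product using (Σ; _×_; _,_; proj₁; proj₂)
open import Data.Product.Properties using (≡-dec)
open import Data.Vec using ([]; _∷_)
open import Function using (_∘_; id; Equivalence)
open import Function.Bundles using (mk⇔)
open import Relation.Binary.Bundles using (Setoid)
import Relation.Binary.PropositionalEquality as ≡
open import Relation.Binary.PropositionalEquality using (_≗_)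
open import Relation.Nullary using (yes; no)

-- Z is a stack of n rows with spectral parameters z₁, …, zₙ (top to
-- bottom), each row being a transfer sum over one horizontal line.  An
-- R-matrix R(x, y) satisfies the local Yang–Baxter equation with the vertex
-- weights; this is a polynomial identity, checked by normalising both sides
-- for all 64 boundary spin configurations.  Pushing R through two adjacent
-- rows column by column (the train argument) and evaluating it on the two
-- boundary columns gives (t x + y)·T(x)T(y) = (t y + x)·T(y)T(x) for rows
-- with right boundary −.  As Δ(…, x, y, …) = Q·(t x + y) with Q symmetric in
-- x and y, the product Δ · Z is invariant under adjacent transpositions of
-- the parameters and hence under all permutations.

foldr-tabulate : ∀ {a b} {A : Set a} {B : Set b} {n} (f : A → B → B) (e : B) (g : Fin n → A) →
  foldr f e (tabulate g) ≡.≡ foldr (λ i → f (g i)) e (allFin n)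
foldr-tabulate {n = zero} f e g = ≡.refl
foldr-tabulate {n = suc n} f e g = ≡.cong (f (g zero))
  (≡.trans (foldr-tabulate f e (g ∘ suc)) (≡.sym (foldr-tabulate (λ i → f (g i)) e suc)))

all-cong : ∀ {A : Set} (xs : List A) {p q : A → Bool} → (∀ a → p a ≡.≡ q a) → all p xs ≡.≡ all q xs
all-cong [] p≡q = ≡.refl
all-cong (x ∷ xs) p≡q = ≡.cong₂ _∧_ (p≡q x) (all-cong xs p≡q)

all-∧ : ∀ {A : Set} (xs : List A) (p q : A → Bool) → all (λ a → p a ∧ q a) xs ≡.≡ all p xs ∧ all q xs
all-∧ [] p q = ≡.refl
all-∧ (x ∷ xs) p q = ≡.trans (≡.cong ((p x ∧ q x) ∧_) (all-∧ xs p q)) (∧-interchange (p x) (q x) (all p xs) (all q xs))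
  where
    open import Algebra.Properties.CommutativeSemigroup (CommutativeMonoid.commutativeSemigroup ∧-commutativeMonoid)
      using () renaming (interchange to ∧-interchange)

all-allFin-suc : ∀ {m} (p : Fin (suc m) → Bool) → all p (allFin (suc m)) ≡.≡ p zero ∧ all (p ∘ suc) (allFin m)
all-allFin-suc p = ≡.cong (λ bs → p zero ∧ and bs) (≡.trans (map-tabulate suc p) (≡.sym (map-tabulate id (p ∘ suc))))

fromIsJust : ∀ {a} {A : Set a} (m : Maybe A) → T (is-just m) → A
fromIsJust (just a) _ = a

tabulate-↭ : ∀ {a} {A : Set a} {n} (σ : Permutation′ n) (z : Fin n → A) → tabulate (z ∘ (σ ⟨$⟩ʳ_)) ↭ tabulate z
tabulate-↭ {n = n} σ z = ≡.subst₂ _↭_ (map-tabulate (σ ⟨$⟩ʳ_) z) (map-tabulate id z) (map⁺ z σ-↭)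
  where
    σ-injective : ∀ {i j} → σ ⟨$⟩ʳ i ≡.≡ σ ⟨$⟩ʳ j → i ≡.≡ j
    σ-injective eq = ≡.trans (≡.sym (inverseˡ σ)) (≡.trans (≡.cong (σ ⟨$⟩ˡ_) eq) (inverseˡ σ))
    -- both lists are duplicate-free and contain every element of Fin n
    σ-↭ : tabulate (σ ⟨$⟩ʳ_) ↭ allFin n
    σ-↭ = ∼bag⇒↭ (unique∧set⇒bag (tabulate⁺ σ-injective) (allFin⁺ n)
      (λ {i} → mk⇔ (λ _ → ∈-allFin i) (λ _ → ≡.subst (_∈ tabulate (σ ⟨$⟩ʳ_)) (inverseʳ σ) (∈-tabulate⁺ (σ ⟨$⟩ˡ i)))))

module AdjacentSwaps {a c ℓ} {A : Set a} (S : Setoid c ℓ) (f : List A → Setoid.Carrier S) where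
  open Setoid S

  ↭-invariant : (∀ xs x y ys → f (xs ++ x ∷ y ∷ ys) ≈ f (xs ++ y ∷ x ∷ ys)) → ∀ {l l′} → l ↭ l′ → f l ≈ f l′
  ↭-invariant swap-invariant l↭l′ = after [] l↭l′
    where
      after : ∀ pre {l l′} → l ↭ l′ → f (pre ++ l) ≈ f (pre ++ l′)
      after pre ↭.refl = refl
      after pre (↭.prep {xs} {ys} x p) =
        trans (reflexive (≡.cong f (≡.sym (++-assoc pre [ x ] xs))))
          (trans (after (pre ++ [ x ]) p) (reflexive (≡.cong f (++-assoc pre [ x ] ys))))
      after pre (↭.swap {xs} {ys} x y p) =
        trans (swap-invariant pre x y xs)
          (trans (reflexive (≡.cong f (≡.sym (++-assoc pre (y ∷ x ∷ []) xs))))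
            (trans (after (pre ++ y ∷ x ∷ []) p) (reflexive (≡.cong f (++-assoc pre (y ∷ x ∷ []) ys)))))
      after pre (↭.trans p q) = trans (after pre p) (after pre q)

_=ˢ_ : Spin → Spin → Bool
u =ˢ plus = isPlus u
u =ˢ minus = isMinus u

everyConfig : (k : ℕ) → (Vec Spin k → Bool) → Bool
everyConfig zero p = p []
everyConfig (suc k) p = everyConfig k (λ ss → p (plus ∷ ss)) ∧ everyConfig k (λ ss → p (minus ∷ ss))

everyConfig-sound : ∀ k p → T (everyConfig k p) → ∀ ss → T (p ss)
everyConfig-sound zero p holds [] = holds
everyConfig-sound (suc k) p holds (plus ∷ ss) = everyConfig-sound k _ (proj₁ (Equivalence.to T-∧ holds)) ss
everyConfig-sound (suc k) p holds (minus ∷ ss) = everyConfig-sound k _ (proj₂ (Equivalence.to T-∧ holds)) ss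

-- The integer a − b is represented by
-- the pair (a , b); `reduce` cancels common successors, so every integer
-- has a unique representative and coefficient equality is decided by ≡.
module IntegerCoefficients {c ℓ} (R : CommutativeRing c ℓ) where
  open CommutativeRing R hiding (zero)
  open import Algebra.Properties.Semiring.Mult.TCOptimised semiring
    using (×-homo-+; ×1-homo-*) renaming (_×_ to _times_)
  open import Algebra.Properties.Group +-group using (ε⁻¹≈ε)
  open import Algebra.Properties.AbelianGroup +-abelianGroup using (⁻¹-anti-homo‿-)
  open import Algebra.Properties.Ring ring using (x[y-z]≈xy-xz; [y-z]x≈yx-zx)
  open NonReflective (Almost.fromCommutativeRing R (λ _ → nothing))
    using (solve; _⊜_; _⊕_; ⊝_)
  open import Relation.Binary.Reasoning.Setoid setoid

  Diff : Set
  Diff = ℕ × ℕ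

  reduce : ℕ → ℕ → Diff
  reduce (suc a) (suc b) = reduce a b
  reduce a b = a , b

  nat : ℕ → Carrier
  nat n = n times 1#

  -- (a , 0) is sent to nat a, so that the coefficients 0 and 1 denote
  -- 0# and 1# definitionally
  ⟦_⟧ℤ : Diff → Carrier
  ⟦ a , zero ⟧ℤ = nat a
  ⟦ a , b ⟧ℤ = nat a - nat b

  ⟦⟧ℤ-correct : ∀ a b → ⟦ a , b ⟧ℤ ≈ nat a - nat b
  ⟦⟧ℤ-correct a zero = sym (trans (+-congˡ ε⁻¹≈ε) (+-identityʳ (nat a)))
  ⟦⟧ℤ-correct a (suc b) = refl

  interchange : ∀ a b c d → (a + c) - (b + d) ≈ (a - b) + (c - d)
  interchange = solve 4 (λ a b c d → ((a ⊕ c) ⊕ ⊝ (b ⊕ d)) ⊜ ((a ⊕ ⊝ b) ⊕ (c ⊕ ⊝ d))) refl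

  reduce-correct : ∀ a b → ⟦ reduce a b ⟧ℤ ≈ nat a - nat b
  reduce-correct zero b = ⟦⟧ℤ-correct zero b
  reduce-correct (suc a) zero = ⟦⟧ℤ-correct (suc a) zero
  reduce-correct (suc a) (suc b) = begin
    ⟦ reduce a b ⟧ℤ                ≈⟨ reduce-correct a b ⟩
    nat a - nat b                  ≈⟨ +-identityˡ (nat a - nat b) ⟨
    0# + (nat a - nat b)           ≈⟨ +-congʳ (-‿inverseʳ 1#) ⟨
    (1# - 1#) + (nat a - nat b)    ≈⟨ interchange 1# 1# (nat a) (nat b) ⟨
    (1# + nat a) - (1# + nat b)    ≈⟨ +-cong (×-homo-+ 1# 1 a) (-‿cong (×-homo-+ 1# 1 b)) ⟨
    nat (suc a) - nat (suc b)      ∎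

  product-of-differences : ∀ x y u v → (x - y) * (u - v) ≈ (x * u + y * v) - (x * v + y * u)
  product-of-differences x y u v = begin
    (x - y) * (u - v)                  ≈⟨ [y-z]x≈yx-zx (u - v) x y ⟩
    x * (u - v) - y * (u - v)          ≈⟨ +-cong (x[y-z]≈xy-xz x u v) (-‿cong (x[y-z]≈xy-xz y u v)) ⟩
    (x * u - x * v) - (y * u - y * v)  ≈⟨ +-congˡ (⁻¹-anti-homo‿- (y * u) (y * v)) ⟩
    (x * u - x * v) + (y * v - y * u)  ≈⟨ regroup (x * u) (x * v) (y * u) (y * v) ⟩
    (x * u + y * v) - (x * v + y * u)  ∎
    where
      regroup : ∀ p q r s → (p - q) + (s - r) ≈ (p + s) - (q + r)
      regroup = solve 4 (λ p q r s → ((p ⊕ ⊝ q) ⊕ (s ⊕ ⊝ r)) ⊜ ((p ⊕ s) ⊕ ⊝ (q ⊕ r))) refl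

  ℤ-rawRing : RawRing _ _
  ℤ-rawRing = record
    { Carrier = Diff
    ; _≈_ = ≡._≡_
    ; _+_ = λ { (a , b) (c , d) → reduce (a ℕ.+ c) (b ℕ.+ d) }
    ; _*_ = λ { (a , b) (c , d) → reduce (a ℕ.* c ℕ.+ b ℕ.* d) (a ℕ.* d ℕ.+ b ℕ.* c) }
    ; -_ = λ { (a , b) → b , a }
    ; 0# = 0 , 0
    ; 1# = 1 , 0
    }

  ℤ-homomorphism : ℤ-rawRing -Raw-AlmostCommutative⟶ fromCommutativeRing R
  ℤ-homomorphism = record
    { ⟦_⟧ = ⟦_⟧ℤ
    ; +-homo = λ { (a , b) (c , d) → begin
        ⟦ reduce (a ℕ.+ c) (b ℕ.+ d) ⟧ℤ      ≈⟨ reduce-correct (a ℕ.+ c) (b ℕ.+ d) ⟩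
        nat (a ℕ.+ c) - nat (b ℕ.+ d)        ≈⟨ +-cong (×-homo-+ 1# a c) (-‿cong (×-homo-+ 1# b d)) ⟩
        (nat a + nat c) - (nat b + nat d)    ≈⟨ interchange (nat a) (nat b) (nat c) (nat d) ⟩
        (nat a - nat b) + (nat c - nat d)    ≈⟨ +-cong (⟦⟧ℤ-correct a b) (⟦⟧ℤ-correct c d) ⟨
        ⟦ a , b ⟧ℤ + ⟦ c , d ⟧ℤ              ∎ }
    ; *-homo = λ { (a , b) (c , d) → begin
        ⟦ reduce (a ℕ.* c ℕ.+ b ℕ.* d) (a ℕ.* d ℕ.+ b ℕ.* c) ⟧ℤ
          ≈⟨ reduce-correct (a ℕ.* c ℕ.+ b ℕ.* d) (a ℕ.* d ℕ.+ b ℕ.* c) ⟩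
        nat (a ℕ.* c ℕ.+ b ℕ.* d) - nat (a ℕ.* d ℕ.+ b ℕ.* c)
          ≈⟨ +-cong (nat-+* a c b d) (-‿cong (nat-+* a d b c)) ⟩
        (nat a * nat c + nat b * nat d) - (nat a * nat d + nat b * nat c)
          ≈⟨ product-of-differences (nat a) (nat b) (nat c) (nat d) ⟨
        (nat a - nat b) * (nat c - nat d)
          ≈⟨ *-cong (⟦⟧ℤ-correct a b) (⟦⟧ℤ-correct c d) ⟨
        ⟦ a , b ⟧ℤ * ⟦ c , d ⟧ℤ ∎ }
    ; -‿homo = λ { (a , b) → begin
        ⟦ b , a ⟧ℤ          ≈⟨ ⟦⟧ℤ-correct b a ⟩
        nat b - nat a       ≈⟨ ⁻¹-anti-homo‿- (nat a) (nat b) ⟨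
        - (nat a - nat b)   ≈⟨ -‿cong (⟦⟧ℤ-correct a b) ⟨
        - ⟦ a , b ⟧ℤ        ∎ }
    ; 0-homo = refl
    ; 1-homo = refl
    }
    where
      nat-+* : ∀ a c b d → nat (a ℕ.* c ℕ.+ b ℕ.* d) ≈ nat a * nat c + nat b * nat d
      nat-+* a c b d = trans (×-homo-+ 1# (a ℕ.* c) (b ℕ.* d)) (+-cong (×1-homo-* a c) (×1-homo-* b d))

  _≟ℤ_ : ∀ p q → Maybe (⟦ p ⟧ℤ ≈ ⟦ q ⟧ℤ)
  p ≟ℤ q with ≡-dec ℕ._≟_ ℕ._≟_ p q
  ... | yes ≡.refl = just refl
  ... | no _ = nothing

  open RingSolver ℤ-rawRing (fromCommutativeRing R) ℤ-homomorphism _≟ℤ_ public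

  0P 1P : ∀ {n} → Polynomial n
  0P = con (0 , 0)
  1P = con (1 , 0)

  _≟P_ : ∀ {n} (p q : Polynomial n) → Maybe (∀ ρ → ⟦ p ⟧ ρ ≈ ⟦ q ⟧ ρ)
  p ≟P q = Maybe.map (λ p≈q ρ → trans (sym (correct p ρ)) (trans (⟦ p≈q ⟧N-cong ρ) (correct q ρ)))
                     (normalise p ≟N normalise q)

module FiniteSums {c ℓ} (R : CommutativeRing c ℓ) where
  open CommutativeRing R hiding (zero)
  open SixVertex R using (sumR; prodR)
  open import Algebra.Properties.CommutativeSemigroup +-commutativeSemigroup
    using () renaming (interchange to +-interchange)
  open import Algebra.Properties.CommutativeSemigroup *-commutativeSemigroup
    using () renaming (interchange to *-interchange)
  open import Relation.Binary.Reasoning.Setoid setoid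

  when : Bool → Carrier → Carrier
  when b x = if b then x else 0#

  when-∧ : ∀ b₁ b₂ x → when (b₁ ∧ b₂) x ≡.≡ when b₁ (when b₂ x)
  when-∧ false b₂ x = ≡.refl
  when-∧ true b₂ x = ≡.refl

  when-cong : ∀ b {x y} → x ≈ y → when b x ≈ when b y
  when-cong false x≈y = refl
  when-cong true x≈y = x≈y

  *-when : ∀ x b y → x * when b y ≈ when b (x * y)
  *-when x false y = zeroʳ x
  *-when x true y = refl

  when-* : ∀ b x y → when b x * y ≈ when b (x * y)
  when-* false x y = zeroˡ y
  when-* true x y = refl

  when-∧-* : ∀ b₁ b₂ x y → when (b₁ ∧ b₂) (x * y) ≈ when b₁ x * when b₂ y
  when-∧-* false b₂ x y = sym (zeroˡ _)
  when-∧-* true b₂ x y = sym (*-when x b₂ y)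

  sum-cong : ∀ {A : Set} (xs : List A) {f g : A → Carrier} → (∀ a → f a ≈ g a) → sumR xs f ≈ sumR xs g
  sum-cong [] f≈g = refl
  sum-cong (x ∷ xs) f≈g = +-cong (f≈g x) (sum-cong xs f≈g)

  prod-cong : ∀ {A : Set} (xs : List A) {f g : A → Carrier} → (∀ a → f a ≈ g a) → prodR xs f ≈ prodR xs g
  prod-cong [] f≈g = refl
  prod-cong (x ∷ xs) f≈g = *-cong (f≈g x) (prod-cong xs f≈g)

  prod-allFin-suc : ∀ {m} (f : Fin (suc m) → Carrier) → prodR (allFin (suc m)) f ≡.≡ f zero * prodR (allFin m) (f ∘ suc)
  prod-allFin-suc f = ≡.cong (f zero *_) (foldr-tabulate (λ a p → f a * p) 1# suc)

  sum-zero : ∀ {A : Set} (xs : List A) → sumR xs (λ _ → 0#) ≈ 0#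
  sum-zero [] = refl
  sum-zero (x ∷ xs) = trans (+-identityˡ _) (sum-zero xs)

  prod-one : ∀ {A : Set} (xs : List A) → prodR xs (λ _ → 1#) ≈ 1#
  prod-one [] = refl
  prod-one (x ∷ xs) = trans (*-identityˡ _) (prod-one xs)

  sum-+ : ∀ {A : Set} (xs : List A) (f g : A → Carrier) → sumR xs (λ a → f a + g a) ≈ sumR xs f + sumR xs g
  sum-+ [] f g = sym (+-identityʳ 0#)
  sum-+ (x ∷ xs) f g = trans (+-congˡ (sum-+ xs f g)) (+-interchange _ _ _ _)

  prod-* : ∀ {A : Set} (xs : List A) (f g : A → Carrier) → prodR xs (λ a → f a * g a) ≈ prodR xs f * prodR xs g
  prod-* [] f g = sym (*-identityʳ 1#)
  prod-* (x ∷ xs) f g = trans (*-congˡ (prod-* xs f g)) (*-interchange _ _ _ _)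

  *-sum : ∀ {A : Set} (xs : List A) k (f : A → Carrier) → k * sumR xs f ≈ sumR xs (λ a → k * f a)
  *-sum [] k f = zeroʳ k
  *-sum (x ∷ xs) k f = trans (distribˡ k _ _) (+-congˡ (*-sum xs k f))

  sum-* : ∀ {A : Set} (xs : List A) k (f : A → Carrier) → sumR xs f * k ≈ sumR xs (λ a → f a * k)
  sum-* xs k f = trans (*-comm _ k) (trans (*-sum xs k f) (sum-cong xs (λ a → *-comm k (f a))))

  sum-swap : ∀ {A B : Set} (xs : List A) (ys : List B) (f : A → B → Carrier) →
    sumR xs (λ a → sumR ys (f a)) ≈ sumR ys (λ b → sumR xs (λ a → f a b))
  sum-swap [] ys f = sym (sum-zero ys)
  sum-swap (x ∷ xs) ys f = trans (+-congˡ (sum-swap xs ys f)) (sym (sum-+ ys (f x) _))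

  sum-product : ∀ {A B : Set} (xs : List A) (ys : List B) (f : A → Carrier) (g : B → Carrier) →
    sumR xs f * sumR ys g ≈ sumR xs (λ a → sumR ys (λ b → f a * g b))
  sum-product xs ys f g = trans (sum-* xs _ f) (sum-cong xs (λ a → *-sum ys (f a) g))

  sum-when : ∀ {A : Set} (xs : List A) b (f : A → Carrier) → sumR xs (λ a → when b (f a)) ≈ when b (sumR xs f)
  sum-when xs false f = sum-zero xs
  sum-when xs true f = refl

  sum-++ : ∀ {A : Set} (xs ys : List A) (f : A → Carrier) → sumR (xs ++ ys) f ≈ sumR xs f + sumR ys f
  sum-++ [] ys f = sym (+-identityˡ _)
  sum-++ (x ∷ xs) ys f = trans (+-congˡ (sum-++ xs ys f)) (sym (+-assoc _ _ _))

  sum-map : ∀ {A B : Set} (g : A → B) (xs : List A) (f : B → Carrier) → sumR (map g xs) f ≈ sumR xs (f ∘ g)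
  sum-map g [] f = refl
  sum-map g (x ∷ xs) f = +-congˡ (sum-map g xs f)

  sum-concatMap : ∀ {A B : Set} (g : A → List B) (xs : List A) (f : B → Carrier) →
    sumR (concatMap g xs) f ≈ sumR xs (λ a → sumR (g a) f)
  sum-concatMap g [] f = refl
  sum-concatMap g (x ∷ xs) f = trans (sum-++ (g x) _ f) (+-congˡ (sum-concatMap g xs f))

  -- A sum over all functions Fin (suc k) → A is a sum over the value at
  -- zero followed by a sum over the remaining values; F′ describes the
  -- summand in terms of these two pieces.
  sum-allFuns-suc : ∀ {A : Set} (xs : List A) k (F : (Fin (suc k) → A) → Carrier)
    (F′ : A → (Fin k → A) → Carrier) → (∀ f → F f ≈ F′ (f zero) (f ∘ suc)) →
    sumR (allFuns xs (suc k)) F ≈ sumR xs (λ a → sumR (allFuns xs k) (F′ a))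
  sum-allFuns-suc xs k F F′ split =
    trans (sum-concatMap _ xs F) (sum-cong xs (λ a → trans (sum-map _ (allFuns xs k) F) (sum-cong (allFuns xs k) (λ f → split _))))

  sum-swap-past-two : ∀ {A B C : Set} (as : List A) (bs : List B) (cs : List C) (F : A → B → C → Carrier) →
    sumR as (λ a → sumR bs (λ b → sumR cs (F a b))) ≈ sumR bs (λ b → sumR cs (λ c → sumR as (λ a → F a b c)))
  sum-swap-past-two as bs cs F = trans (sum-swap as bs _) (sum-cong bs (λ b → sum-swap as cs (λ a → F a b)))

  sum-assoc : ∀ {A B : Set} (as : List A) (bs : List B) (f : A → Carrier) (g : A → B → Carrier) (h : B → Carrier) →
    sumR as (λ a → f a * sumR bs (λ b → g a b * h b)) ≈ sumR bs (λ b → sumR as (λ a → f a * g a b) * h b)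
  sum-assoc as bs f g h = begin
    sumR as (λ a → f a * sumR bs (λ b → g a b * h b))
      ≈⟨ sum-cong as (λ a → trans (*-sum bs (f a) _) (sum-cong bs (λ b → sym (*-assoc (f a) (g a b) (h b))))) ⟩
    sumR as (λ a → sumR bs (λ b → (f a * g a b) * h b))
      ≈⟨ sum-swap as bs _ ⟩
    sumR bs (λ b → sumR as (λ a → (f a * g a b) * h b))
      ≈⟨ sum-cong bs (λ b → sym (sum-* as (h b) _)) ⟩
    sumR bs (λ b → sumR as (λ a → f a * g a b) * h b) ∎

  -- The rearrangement behind the column-by-column recursion for two rows:
  -- Σ_{m,b} (Σ_u f u m · g u b)(Σ_v h v m · k v b) = Σ_{u,v} (Σ_m f u m · h v m)(Σ_b g u b · k v b).
  sum-of-products-rearrange : ∀ {M B U : Set} (ms : List M) (bs : List B) (us : List U)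
    (f h : U → M → Carrier) (g k : U → B → Carrier) →
    sumR ms (λ m → sumR bs (λ b → sumR us (λ u → f u m * g u b) * sumR us (λ v → h v m * k v b)))
    ≈ sumR us (λ u → sumR us (λ v → sumR ms (λ m → f u m * h v m) * sumR bs (λ b → g u b * k v b)))
  sum-of-products-rearrange {M} {B} {U} ms bs us f h g k = begin
    sumR ms (λ m → sumR bs (λ b → sumR us (λ u → f u m * g u b) * sumR us (λ v → h v m * k v b)))
      ≈⟨ sum-cong ms (λ m → sum-cong bs (λ b → trans (sum-product us us _ _)
           (sum-cong us (λ u → sum-cong us (λ v → *-interchange (f u m) (g u b) (h v m) (k v b)))))) ⟩
    sumR ms (λ m → sumR bs (λ b → sumR us (λ u → sumR us (λ v → F u v m b))))
      ≈⟨ sum-cong ms (λ m → sum-swap-past-two bs us us (λ b u v → F u v m b)) ⟩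
    sumR ms (λ m → sumR us (λ u → sumR us (λ v → sumR bs (F u v m))))
      ≈⟨ sum-swap-past-two ms us us (λ m u v → sumR bs (F u v m)) ⟩
    sumR us (λ u → sumR us (λ v → sumR ms (λ m → sumR bs (F u v m))))
      ≈⟨ sum-cong us (λ u → sum-cong us (λ v → sym (sum-product ms bs _ _))) ⟩
    sumR us (λ u → sumR us (λ v → sumR ms (λ m → f u m * h v m) * sumR bs (λ b → g u b * k v b))) ∎
    where
      F : U → U → M → B → Carrier
      F u v m b = (f u m * h v m) * (g u b * k v b)


  sum-select : ∀ s (F : Spin → Carrier) → sumR spins (λ s₀ → when (s₀ =ˢ s) (F s₀)) ≈ F s
  sum-select plus F = trans (+-congˡ (+-identityˡ 0#)) (+-identityʳ (F plus))
  sum-select minus F = trans (+-identityˡ _) (+-identityʳ (F minus))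

  sum-select′ : ∀ s (F : Spin → Carrier) → sumR spins (λ s₀ → when (s =ˢ s₀) (F s₀)) ≈ F s
  sum-select′ plus F = trans (+-congˡ (+-identityˡ 0#)) (+-identityʳ (F plus))
  sum-select′ minus F = trans (+-identityˡ _) (+-identityʳ (F minus))

  _∷ᶠ_ : ∀ {k} → Spin → (Fin k → Spin) → Fin (suc k) → Spin
  (s ∷ᶠ u) zero = s
  (s ∷ᶠ u) (suc j) = u j

  -- Summing against the indicator of u = cc selects u = cc; since
  -- configurations are functions, Φ must respect pointwise equality.
  sum-point-mass : ∀ k (cc : Fin k → Spin) (Φ : (Fin k → Spin) → Carrier) → (∀ {u u′} → u ≗ u′ → Φ u ≈ Φ u′) →
    sumR (allFuns spins k) (λ u → when (all (λ j → u j =ˢ cc j) (allFin k)) 1# * Φ u) ≈ Φ cc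
  sum-point-mass zero cc Φ Φ-resp = trans (+-identityʳ _) (trans (*-identityˡ _) (Φ-resp (λ ())))
  sum-point-mass (suc k) cc Φ Φ-resp = begin
    sumR (allFuns spins (suc k)) (λ u → when (all (λ j → u j =ˢ cc j) (allFin (suc k))) 1# * Φ u)
      ≈⟨ sum-allFuns-suc spins k _ (λ s u → when (s =ˢ cc zero) (rest s u)) split ⟩
    sumR spins (λ s → sumR (allFuns spins k) (λ u → when (s =ˢ cc zero) (rest s u)))
      ≈⟨ sum-cong spins (λ s → sum-when (allFuns spins k) (s =ˢ cc zero) (rest s)) ⟩
    sumR spins (λ s → when (s =ˢ cc zero) (sumR (allFuns spins k) (rest s)))
      ≈⟨ sum-select (cc zero) (λ s → sumR (allFuns spins k) (rest s)) ⟩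
    sumR (allFuns spins k) (rest (cc zero))
      ≈⟨ sum-point-mass k (cc ∘ suc) (λ u → Φ (cc zero ∷ᶠ u)) (λ u≗u′ → Φ-resp (λ { zero → ≡.refl ; (suc j) → u≗u′ j })) ⟩
    Φ (cc zero ∷ᶠ (cc ∘ suc))
      ≈⟨ Φ-resp (λ { zero → ≡.refl ; (suc j) → ≡.refl }) ⟩
    Φ cc ∎
    where
      rest : Spin → (Fin k → Spin) → Carrier
      rest s u = when (all (λ j → u j =ˢ cc (suc j)) (allFin k)) 1# * Φ (s ∷ᶠ u)
      split : ∀ (u : Fin (suc k) → Spin) →
        when (all (λ j → u j =ˢ cc j) (allFin (suc k))) 1# * Φ u ≈ when (u zero =ˢ cc zero) (rest (u zero) (u ∘ suc))
      split u = begin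
        when (all (λ j → u j =ˢ cc j) (allFin (suc k))) 1# * Φ u
          ≈⟨ *-congʳ (reflexive (≡.trans (≡.cong (λ b → when b 1#) (all-allFin-suc (λ j → u j =ˢ cc j)))
                                          (when-∧ (u zero =ˢ cc zero) _ 1#))) ⟩
        when (u zero =ˢ cc zero) (when (all (λ j → u (suc j) =ˢ cc (suc j)) (allFin k)) 1#) * Φ u
          ≈⟨ when-* (u zero =ˢ cc zero) _ (Φ u) ⟩
        when (u zero =ˢ cc zero) (when (all (λ j → u (suc j) =ˢ cc (suc j)) (allFin k)) 1# * Φ u)
          ≈⟨ when-cong (u zero =ˢ cc zero) (*-congˡ (Φ-resp (λ { zero → ≡.refl ; (suc j) → ≡.refl }))) ⟩
        when (u zero =ˢ cc zero) (rest (u zero) (u ∘ suc)) ∎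

-- All local identities of the model (the
-- Yang–Baxter equation, the action of the R-matrix at the boundaries) are
-- polynomial identities in the parameters, indexed by finitely many
-- boundary spins.  We write the weights as polynomial expressions and
-- verify such families of identities by normalising both sides for every
-- spin configuration during type checking.
module SpinPolynomials {c ℓ} (R : CommutativeRing c ℓ) where
  open CommutativeRing R hiding (zero)
  open SixVertex R using (vweight; sumR)
  open IntegerCoefficients R
  open import Algebra.Properties.Semiring.Exp semiring using (_^_)
  open FiniteSums R
  open import Relation.Binary.Reasoning.Setoid setoid

  byNormalisation : ∀ k {n} (lhs rhs : Vec Spin k → Polynomial n) →
    T (everyConfig k (λ ss → is-just (lhs ss ≟P rhs ss))) → ∀ ss ρ → ⟦ lhs ss ⟧ ρ ≈ ⟦ rhs ss ⟧ ρ
  byNormalisation k lhs rhs checked ss =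
    fromIsJust (lhs ss ≟P rhs ss) (everyConfig-sound k (λ ss → is-just (lhs ss ≟P rhs ss)) checked ss)

  weaken : ∀ {n} → Polynomial n → Polynomial (suc n)
  weaken (op o p q) = op o (weaken p) (weaken q)
  weaken (con k) = con k
  weaken (var i) = var (suc i)
  weaken (p :^ k) = weaken p :^ k
  weaken (:- p) = :- weaken p

  weaken-sound : ∀ {n} (p : Polynomial n) a ρ → ⟦ weaken p ⟧ (a ∷ ρ) ≡.≡ ⟦ p ⟧ ρ
  weaken-sound (op o p q) a ρ = ≡.cong₂ (sem o) (weaken-sound p a ρ) (weaken-sound q a ρ)
  weaken-sound (con k) a ρ = ≡.refl
  weaken-sound (var i) a ρ = ≡.refl
  weaken-sound (p :^ k) a ρ = ≡.cong (_^ k) (weaken-sound p a ρ)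
  weaken-sound (:- p) a ρ = ≡.cong -_ (weaken-sound p a ρ)

  sumP : ∀ {n} → (Spin → Polynomial n) → Polynomial n
  sumP f = f plus :+ (f minus :+ 0P)

  𝐱 𝐲 𝐭 : Polynomial 3
  𝐱 = var zero
  𝐲 = var (suc zero)
  𝐭 = var (suc (suc zero))

  -- The entries of the R-matrix, as polynomials in x, y, t: the entry
  -- R(s₁ s₂; u₁ u₂) has right spins s₁, s₂ and left spins u₁, u₂.
  R-entry : ∀ {n} (X Y T : Polynomial n) → Spin → Spin → Spin → Spin → Polynomial n
  R-entry X Y T plus  plus  plus  plus  = T :* Y :+ X
  R-entry X Y T minus minus minus minus = T :* X :+ Y
  R-entry X Y T plus  minus plus  minus = (T :+ 1P) :* Y
  R-entry X Y T minus plus  minus plus  = (T :+ 1P) :* X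
  R-entry X Y T plus  minus minus plus  = T :* (X :- Y)
  R-entry X Y T minus plus  plus  minus = Y :- X
  R-entry X Y T _     _     _     _     = 0P

  Rmatrix : (t x y : Carrier) → Spin → Spin → Spin → Spin → Carrier
  Rmatrix t x y s₁ s₂ u₁ u₂ = ⟦ R-entry 𝐱 𝐲 𝐭 s₁ s₂ u₁ u₂ ⟧ (x ∷ y ∷ t ∷ [])

  vertex-entry : ∀ {n} (Z T A : Polynomial n) → Spin → Spin → Spin → Spin → Polynomial n
  vertex-entry Z T A plus  plus  plus  plus  = 1P
  vertex-entry Z T A minus minus minus minus = Z :- T :* A
  vertex-entry Z T A plus  minus plus  minus = T
  vertex-entry Z T A minus plus  minus plus  = Z :+ A
  vertex-entry Z T A minus plus  plus  minus = Z :* (T :+ 1P)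
  vertex-entry Z T A plus  minus minus plus  = 1P
  vertex-entry Z T A _     _     _     _     = 0P

  vertex-entry-sound : ∀ {n} (Z T A : Polynomial n) ρ l u r d →
    ⟦ vertex-entry Z T A l u r d ⟧ ρ ≡.≡ vweight (⟦ T ⟧ ρ) (⟦ Z ⟧ ρ) (⟦ A ⟧ ρ) l u r d
  vertex-entry-sound Z T A ρ plus  plus  plus  plus  = ≡.refl
  vertex-entry-sound Z T A ρ plus  plus  plus  minus = ≡.refl
  vertex-entry-sound Z T A ρ plus  plus  minus plus  = ≡.refl
  vertex-entry-sound Z T A ρ plus  plus  minus minus = ≡.refl
  vertex-entry-sound Z T A ρ plus  minus plus  plus  = ≡.refl
  vertex-entry-sound Z T A ρ plus  minus plus  minus = ≡.refl
  vertex-entry-sound Z T A ρ plus  minus minus plus  = ≡.refl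
  vertex-entry-sound Z T A ρ plus  minus minus minus = ≡.refl
  vertex-entry-sound Z T A ρ minus plus  plus  plus  = ≡.refl
  vertex-entry-sound Z T A ρ minus plus  plus  minus = ≡.refl
  vertex-entry-sound Z T A ρ minus plus  minus plus  = ≡.refl
  vertex-entry-sound Z T A ρ minus plus  minus minus = ≡.refl
  vertex-entry-sound Z T A ρ minus minus plus  plus  = ≡.refl
  vertex-entry-sound Z T A ρ minus minus plus  minus = ≡.refl
  vertex-entry-sound Z T A ρ minus minus minus plus  = ≡.refl
  vertex-entry-sound Z T A ρ minus minus minus minus = ≡.refl

  -- One column of two stacked rows (parameter x above y) with column
  -- parameter a: right spins s₁ s₂, left spins u₁ u₂, top c, bottom d.
  column : (t x y a : Carrier) → Spin → Spin → Spin → Spin → Spin → Spin → Carrier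
  column t x y a s₁ s₂ u₁ u₂ c d = sumR spins (λ m → vweight t x a u₁ c s₁ m * vweight t y a u₂ m s₂ d)

  sum² : (Spin → Spin → Carrier) → Carrier
  sum² f = sumR spins (λ u₁ → sumR spins (f u₁))

  sum²-cong : ∀ {f g} → (∀ u₁ u₂ → f u₁ u₂ ≈ g u₁ u₂) → sum² f ≈ sum² g
  sum²-cong f≈g = sum-cong spins (λ u₁ → sum-cong spins (f≈g u₁))

  *-sum² : ∀ k f → k * sum² f ≈ sum² (λ u₁ u₂ → k * f u₁ u₂)
  *-sum² k f = trans (*-sum spins k (λ u₁ → sumR spins (f u₁))) (sum-cong spins (λ u₁ → *-sum spins k (f u₁)))

  sum²-* : ∀ k f → sum² f * k ≈ sum² (λ u₁ u₂ → f u₁ u₂ * k)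
  sum²-* k f = trans (sum-* spins k (λ u₁ → sumR spins (f u₁))) (sum-cong spins (λ u₁ → sum-* spins k (f u₁)))

  sum²-assoc : ∀ (A : Spin → Spin → Carrier) (B : Spin → Spin → Spin → Spin → Carrier) (C : Spin → Spin → Carrier) →
    sum² (λ u₁ u₂ → A u₁ u₂ * sum² (λ v₁ v₂ → B u₁ u₂ v₁ v₂ * C v₁ v₂))
    ≈ sum² (λ v₁ v₂ → sum² (λ u₁ u₂ → A u₁ u₂ * B u₁ u₂ v₁ v₂) * C v₁ v₂)
  sum²-assoc A B C = begin
    sum² (λ u₁ u₂ → A u₁ u₂ * sum² (λ v₁ v₂ → B u₁ u₂ v₁ v₂ * C v₁ v₂))
      ≈⟨ sum²-cong (λ u₁ u₂ → trans (*-sum² (A u₁ u₂) (λ v₁ v₂ → B u₁ u₂ v₁ v₂ * C v₁ v₂))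
                                     (sum²-cong (λ v₁ v₂ → sym (*-assoc (A u₁ u₂) (B u₁ u₂ v₁ v₂) (C v₁ v₂))))) ⟩
    sum² (λ u₁ u₂ → sum² (λ v₁ v₂ → F u₁ u₂ v₁ v₂))
      ≈⟨ sum-cong spins (λ u₁ → sum-swap-past-two spins spins spins (F u₁)) ⟩
    sumR spins (λ u₁ → sum² (λ v₁ v₂ → sumR spins (λ u₂ → F u₁ u₂ v₁ v₂)))
      ≈⟨ sum-swap-past-two spins spins spins (λ u₁ v₁ v₂ → sumR spins (λ u₂ → F u₁ u₂ v₁ v₂)) ⟩
    sum² (λ v₁ v₂ → sum² (λ u₁ u₂ → F u₁ u₂ v₁ v₂))
      ≈⟨ sum²-cong (λ v₁ v₂ → sum²-* (C v₁ v₂) (λ u₁ u₂ → A u₁ u₂ * B u₁ u₂ v₁ v₂)) ⟨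
    sum² (λ v₁ v₂ → sum² (λ u₁ u₂ → A u₁ u₂ * B u₁ u₂ v₁ v₂) * C v₁ v₂) ∎
    where
      F : Spin → Spin → Spin → Spin → Carrier
      F u₁ u₂ v₁ v₂ = (A u₁ u₂ * B u₁ u₂ v₁ v₂) * C v₁ v₂

  private
    𝐚₄ 𝐱₄ 𝐲₄ 𝐭₄ : Polynomial 4
    𝐚₄ = var zero
    𝐱₄ = var (suc zero)
    𝐲₄ = var (suc (suc zero))
    𝐭₄ = var (suc (suc (suc zero)))

    columnP : Polynomial 4 → Polynomial 4 → Spin → Spin → Spin → Spin → Spin → Spin → Polynomial 4
    columnP x y s₁ s₂ u₁ u₂ c d = sumP (λ m → vertex-entry x 𝐭₄ 𝐚₄ u₁ c s₁ m :* vertex-entry y 𝐭₄ 𝐚₄ u₂ m s₂ d)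

    columnP-sound : ∀ (P Q : Polynomial 4) ρ s₁ s₂ u₁ u₂ c d →
      ⟦ columnP P Q s₁ s₂ u₁ u₂ c d ⟧ ρ ≈ column (⟦ 𝐭₄ ⟧ ρ) (⟦ P ⟧ ρ) (⟦ Q ⟧ ρ) (⟦ 𝐚₄ ⟧ ρ) s₁ s₂ u₁ u₂ c d
    columnP-sound P Q ρ s₁ s₂ u₁ u₂ c d = sum-cong spins (λ m →
      *-cong (reflexive (vertex-entry-sound P 𝐭₄ 𝐚₄ ρ u₁ c s₁ m)) (reflexive (vertex-entry-sound Q 𝐭₄ 𝐚₄ ρ u₂ m s₂ d)))

    RP : Spin → Spin → Spin → Spin → Polynomial 4
    RP s₁ s₂ u₁ u₂ = weaken (R-entry 𝐱 𝐲 𝐭 s₁ s₂ u₁ u₂)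

    RP-sound : ∀ t x y a s₁ s₂ u₁ u₂ → ⟦ RP s₁ s₂ u₁ u₂ ⟧ (a ∷ x ∷ y ∷ t ∷ []) ≈ Rmatrix t x y s₁ s₂ u₁ u₂
    RP-sound t x y a s₁ s₂ u₁ u₂ = reflexive (weaken-sound (R-entry 𝐱 𝐲 𝐭 s₁ s₂ u₁ u₂) a (x ∷ y ∷ t ∷ []))

    -- the two sides of the Yang–Baxter equation, for the boundary spins
    -- s₁ s₂ (right), v₁ v₂ (left), c (top) and d (bottom)
    yang-baxter-lhs yang-baxter-rhs : Vec Spin 6 → Polynomial 4
    yang-baxter-lhs (s₁ ∷ s₂ ∷ v₁ ∷ v₂ ∷ c ∷ d ∷ []) =
      sumP λ u₁ → sumP λ u₂ → RP s₁ s₂ u₁ u₂ :* columnP 𝐱₄ 𝐲₄ u₁ u₂ v₁ v₂ c d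
    yang-baxter-rhs (s₁ ∷ s₂ ∷ v₁ ∷ v₂ ∷ c ∷ d ∷ []) =
      sumP λ u₁ → sumP λ u₂ → columnP 𝐲₄ 𝐱₄ s₁ s₂ u₁ u₂ c d :* RP u₁ u₂ v₁ v₂

  yang-baxter : ∀ t x y a s₁ s₂ v₁ v₂ c d →
    sum² (λ u₁ u₂ → Rmatrix t x y s₁ s₂ u₁ u₂ * column t x y a u₁ u₂ v₁ v₂ c d)
    ≈ sum² (λ u₁ u₂ → column t y x a s₁ s₂ u₁ u₂ c d * Rmatrix t x y u₁ u₂ v₁ v₂)
  yang-baxter t x y a s₁ s₂ v₁ v₂ c d = begin
    sum² (λ u₁ u₂ → Rmatrix t x y s₁ s₂ u₁ u₂ * column t x y a u₁ u₂ v₁ v₂ c d)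
      ≈⟨ sum²-cong (λ u₁ u₂ → *-cong (RP-sound t x y a s₁ s₂ u₁ u₂) (columnP-sound 𝐱₄ 𝐲₄ ρ u₁ u₂ v₁ v₂ c d)) ⟨
    ⟦ yang-baxter-lhs spins⁶ ⟧ ρ
      ≈⟨ byNormalisation 6 yang-baxter-lhs yang-baxter-rhs _ spins⁶ ρ ⟩
    ⟦ yang-baxter-rhs spins⁶ ⟧ ρ
      ≈⟨ sum²-cong (λ u₁ u₂ → *-cong (columnP-sound 𝐲₄ 𝐱₄ ρ s₁ s₂ u₁ u₂ c d) (RP-sound t x y a u₁ u₂ v₁ v₂)) ⟩
    sum² (λ u₁ u₂ → column t y x a s₁ s₂ u₁ u₂ c d * Rmatrix t x y u₁ u₂ v₁ v₂) ∎
    where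
      spins⁶ : Vec Spin 6
      spins⁶ = s₁ ∷ s₂ ∷ v₁ ∷ v₂ ∷ c ∷ d ∷ []
      ρ : Vec Carrier 4
      ρ = a ∷ x ∷ y ∷ t ∷ []

-- Rows of the lattice and the train argument.  Rows are built column by
-- column from the right; all left boundary spins are +.
module Rows {c ℓ} (R : CommutativeRing c ℓ) (t : CommutativeRing.Carrier R) where
  open CommutativeRing R hiding (zero)
  open SixVertex R using (vweight; sumR)
  open IntegerCoefficients R using (Polynomial; ⟦_⟧; solve; _:=_; _:+_; _:*_; 0P; 1P)
  open FiniteSums R
  open SpinPolynomials R
  open import Algebra.Properties.CommutativeSemigroup *-commutativeSemigroup using (x∙yz≈y∙xz)
  open import Relation.Binary.Reasoning.Setoid setoid

  Config : ℕ → Set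
  Config K = Fin K → Spin

  -- the weight of a left boundary spin: left boundary edges are +
  plusIndicator : Spin → Carrier
  plusIndicator plus = 1#
  plusIndicator minus = 0#

  -- Partition function of one row of K vertices with row parameter x,
  -- column parameters α 1, …, α K (numbered from the right), top spins a,
  -- bottom spins b and right boundary spin s.
  row : (K : ℕ) (x : Carrier) (α : ℕ → Carrier) → Spin → Config K → Config K → Carrier
  row zero x α s a b = plusIndicator s
  row (suc K) x α s a b =
    sumR spins (λ s′ → vweight t x (α 1) s′ (a zero) s (b zero) * row K x (α ∘ suc) s′ (a ∘ suc) (b ∘ suc))

  row-resp : ∀ K x α s {a a′ : Config K} (b : Config K) → a ≗ a′ → row K x α s a b ≈ row K x α s a′ b
  row-resp zero x α s b a≗a′ = refl
  row-resp (suc K) x α s b a≗a′ = sum-cong spins (λ s′ →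
    *-cong (reflexive (≡.cong (λ top → vweight t x (α 1) s′ top s (b zero)) (a≗a′ zero)))
           (row-resp K x (α ∘ suc) s′ (b ∘ suc) (a≗a′ ∘ suc)))

  twoRows : (K : ℕ) (x y : Carrier) (α : ℕ → Carrier) → Spin → Spin → Config K → Config K → Carrier
  twoRows K x y α s₁ s₂ a c = sumR (allFuns spins K) (λ b → row K x α s₁ a b * row K y α s₂ b c)

  twoRows-step : ∀ K x y α s₁ s₂ (a c : Config (suc K)) →
    twoRows (suc K) x y α s₁ s₂ a c
    ≈ sum² (λ u₁ u₂ → column t x y (α 1) s₁ s₂ u₁ u₂ (a zero) (c zero) * twoRows K x y (α ∘ suc) u₁ u₂ (a ∘ suc) (c ∘ suc))
  twoRows-step K x y α s₁ s₂ a c =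
    trans (sum-allFuns-suc spins K _ (λ m b → sumR spins (λ u → f u m * g u b) * sumR spins (λ v → h v m * k v b)) (λ _ → refl))
          (sum-of-products-rearrange spins (allFuns spins K) spins f h g k)
    where
      f h : Spin → Spin → Carrier
      f u m = vweight t x (α 1) u (a zero) s₁ m
      h v m = vweight t y (α 1) v m s₂ (c zero)
      g k : Spin → Config K → Carrier
      g u b = row K x (α ∘ suc) u (a ∘ suc) b
      k v b = row K y (α ∘ suc) v b (c ∘ suc)

  private
    plusIndicatorP : Spin → Polynomial 3
    plusIndicatorP plus = 1P
    plusIndicatorP minus = 0P

    plusIndicatorP-sound : ∀ ρ s → ⟦ plusIndicatorP s ⟧ ρ ≈ plusIndicator s
    plusIndicatorP-sound ρ plus = refl
    plusIndicatorP-sound ρ minus = refl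

    train-base-lhs train-base-rhs : Vec Spin 2 → Polynomial 3
    train-base-lhs (s₁ ∷ s₂ ∷ []) = sumP λ u₁ → sumP λ u₂ →
      R-entry 𝐱 𝐲 𝐭 s₁ s₂ u₁ u₂ :* (plusIndicatorP u₁ :* plusIndicatorP u₂ :+ 0P)
    train-base-rhs (s₁ ∷ s₂ ∷ []) = (𝐭 :* 𝐲 :+ 𝐱) :* (plusIndicatorP s₁ :* plusIndicatorP s₂ :+ 0P)

  -- At the left boundary both rows end in +, and the only entry of the
  -- R-matrix ending in (+, +) is R(++; ++) = t y + x.
  train-base : ∀ x y α s₁ s₂ (a c : Config 0) →
    sum² (λ u₁ u₂ → Rmatrix t x y s₁ s₂ u₁ u₂ * twoRows 0 x y α u₁ u₂ a c) ≈ (t * y + x) * twoRows 0 y x α s₁ s₂ a c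
  train-base x y α s₁ s₂ a c = begin
    sum² (λ u₁ u₂ → Rmatrix t x y s₁ s₂ u₁ u₂ * twoRows 0 x y α u₁ u₂ a c)
      ≈⟨ sum²-cong (λ u₁ u₂ → *-congˡ {Rmatrix t x y s₁ s₂ u₁ u₂} (+-congʳ {0#} (indicators-sound u₁ u₂))) ⟨
    ⟦ train-base-lhs (s₁ ∷ s₂ ∷ []) ⟧ ρ
      ≈⟨ byNormalisation 2 train-base-lhs train-base-rhs _ (s₁ ∷ s₂ ∷ []) ρ ⟩
    ⟦ train-base-rhs (s₁ ∷ s₂ ∷ []) ⟧ ρ
      ≈⟨ *-congˡ (+-congʳ (indicators-sound s₁ s₂)) ⟩
    (t * y + x) * twoRows 0 y x α s₁ s₂ a c ∎
    where
      ρ : Vec Carrier 3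
      ρ = x ∷ y ∷ t ∷ []
      indicators-sound : ∀ u₁ u₂ → ⟦ plusIndicatorP u₁ ⟧ ρ * ⟦ plusIndicatorP u₂ ⟧ ρ ≈ plusIndicator u₁ * plusIndicator u₂
      indicators-sound u₁ u₂ = *-cong (plusIndicatorP-sound ρ u₁) (plusIndicatorP-sound ρ u₂)

  -- The train argument: an R-matrix attached to the right end of two rows
  -- can be pushed through all K columns, exchanging the row parameters;
  -- at the left end it contributes the factor t y + x.
  train : ∀ K x y α s₁ s₂ (a c : Config K) →
    sum² (λ u₁ u₂ → Rmatrix t x y s₁ s₂ u₁ u₂ * twoRows K x y α u₁ u₂ a c) ≈ (t * y + x) * twoRows K y x α s₁ s₂ a c
  train zero x y α s₁ s₂ a c = train-base x y α s₁ s₂ a c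
  train (suc K) x y α s₁ s₂ a c = begin
    sum² (λ u₁ u₂ → Rmatrix t x y s₁ s₂ u₁ u₂ * twoRows (suc K) x y α u₁ u₂ a c)
      ≈⟨ sum²-cong (λ u₁ u₂ → *-congˡ {Rmatrix t x y s₁ s₂ u₁ u₂} (twoRows-step K x y α u₁ u₂ a c)) ⟩
    sum² (λ u₁ u₂ → Rmatrix t x y s₁ s₂ u₁ u₂ * sum² (λ v₁ v₂ → column t x y a₁ u₁ u₂ v₁ v₂ c₀ d₀ * rest x y v₁ v₂))
      ≈⟨ sum²-assoc (Rmatrix t x y s₁ s₂) (λ u₁ u₂ v₁ v₂ → column t x y a₁ u₁ u₂ v₁ v₂ c₀ d₀) (rest x y) ⟩
    sum² (λ v₁ v₂ → sum² (λ u₁ u₂ → Rmatrix t x y s₁ s₂ u₁ u₂ * column t x y a₁ u₁ u₂ v₁ v₂ c₀ d₀) * rest x y v₁ v₂)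
      ≈⟨ sum²-cong (λ v₁ v₂ → *-congʳ {rest x y v₁ v₂} (yang-baxter t x y a₁ s₁ s₂ v₁ v₂ c₀ d₀)) ⟩
    sum² (λ v₁ v₂ → sum² (λ u₁ u₂ → column t y x a₁ s₁ s₂ u₁ u₂ c₀ d₀ * Rmatrix t x y u₁ u₂ v₁ v₂) * rest x y v₁ v₂)
      ≈⟨ sum²-assoc (λ u₁ u₂ → column t y x a₁ s₁ s₂ u₁ u₂ c₀ d₀) (Rmatrix t x y) (rest x y) ⟨
    sum² (λ u₁ u₂ → column t y x a₁ s₁ s₂ u₁ u₂ c₀ d₀ * sum² (λ v₁ v₂ → Rmatrix t x y u₁ u₂ v₁ v₂ * rest x y v₁ v₂))
      ≈⟨ sum²-cong (λ u₁ u₂ → *-congˡ {column t y x a₁ s₁ s₂ u₁ u₂ c₀ d₀} (train K x y (α ∘ suc) u₁ u₂ (a ∘ suc) (c ∘ suc))) ⟩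
    sum² (λ u₁ u₂ → column t y x a₁ s₁ s₂ u₁ u₂ c₀ d₀ * ((t * y + x) * rest y x u₁ u₂))
      ≈⟨ sum²-cong (λ u₁ u₂ → x∙yz≈y∙xz (column t y x a₁ s₁ s₂ u₁ u₂ c₀ d₀) (t * y + x) (rest y x u₁ u₂)) ⟩
    sum² (λ u₁ u₂ → (t * y + x) * (column t y x a₁ s₁ s₂ u₁ u₂ c₀ d₀ * rest y x u₁ u₂))
      ≈⟨ *-sum² (t * y + x) (λ u₁ u₂ → column t y x a₁ s₁ s₂ u₁ u₂ c₀ d₀ * rest y x u₁ u₂) ⟨
    (t * y + x) * sum² (λ u₁ u₂ → column t y x a₁ s₁ s₂ u₁ u₂ c₀ d₀ * rest y x u₁ u₂)
      ≈⟨ *-congˡ (twoRows-step K y x α s₁ s₂ a c) ⟨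
    (t * y + x) * twoRows (suc K) y x α s₁ s₂ a c ∎
    where
      a₁ : Carrier
      a₁ = α 1
      c₀ d₀ : Spin
      c₀ = a zero
      d₀ = c zero
      rest : Carrier → Carrier → Spin → Spin → Carrier
      rest x′ y′ v₁ v₂ = twoRows K x′ y′ (α ∘ suc) v₁ v₂ (a ∘ suc) (c ∘ suc)

  -- The only entry of the R-matrix starting from (−, −) is R(−−; −−) = t x + y.
  R-from-minus : ∀ x y (D : Spin → Spin → Carrier) →
    sum² (λ u₁ u₂ → Rmatrix t x y minus minus u₁ u₂ * D u₁ u₂) ≈ (t * x + y) * D minus minus
  R-from-minus x y D =
    solve 7 (λ x y t d₊₊ d₊₋ d₋₊ d₋₋ → sumP (λ u₁ → sumP (λ u₂ → R-entry x y t minus minus u₁ u₂ :* pick d₊₊ d₊₋ d₋₊ d₋₋ u₁ u₂))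
                                        := (t :* x :+ y) :* d₋₋)
      refl x y t (D plus plus) (D plus minus) (D minus plus) (D minus minus)
    where
      pick : ∀ {A : Set} → A → A → A → A → Spin → Spin → A
      pick d₊₊ d₊₋ d₋₊ d₋₋ plus plus = d₊₊
      pick d₊₊ d₊₋ d₋₊ d₋₋ plus minus = d₊₋
      pick d₊₊ d₊₋ d₋₊ d₋₋ minus plus = d₋₊
      pick d₊₊ d₊₋ d₋₊ d₋₋ minus minus = d₋₋

  row-exchange : ∀ K x y α (a c : Config K) →
    (t * x + y) * twoRows K x y α minus minus a c ≈ (t * y + x) * twoRows K y x α minus minus a c
  row-exchange K x y α a c =
    trans (sym (R-from-minus x y (λ u₁ u₂ → twoRows K x y α u₁ u₂ a c))) (train K x y α minus minus a c)

module DeltaFactor {c ℓ} (R : CommutativeRing c ℓ) (t : CommutativeRing.Carrier R) where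
  open CommutativeRing R hiding (zero)
  open SixVertex R using (prodR; deltaFactor)
  open IntegerCoefficients R using (solve; _:=_; _:*_)
  open FiniteSums R
  open import Algebra.Properties.CommutativeSemigroup *-commutativeSemigroup using (x∙yz≈y∙xz)
  open import Relation.Binary.Reasoning.Setoid setoid

  factors : Carrier → List Carrier → Carrier
  factors x = foldr (λ y p → (t * x + y) * p) 1#

  Δ : List Carrier → Carrier
  Δ [] = 1#
  Δ (x ∷ zs) = factors x zs * Δ zs

  factors-exchange : ∀ x xs a b ys → factors x (xs ++ a ∷ b ∷ ys) ≈ factors x (xs ++ b ∷ a ∷ ys)
  factors-exchange x [] a b ys = x∙yz≈y∙xz (t * x + a) (t * x + b) _
  factors-exchange x (y ∷ xs) a b ys = *-congˡ (factors-exchange x xs a b ys)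

  Δ-exchange : ∀ xs a b ys → Σ Carrier λ Q →
    Δ (xs ++ a ∷ b ∷ ys) ≈ Q * (t * a + b) × Δ (xs ++ b ∷ a ∷ ys) ≈ Q * (t * b + a)
  Δ-exchange [] a b ys =
    factors a ys * (factors b ys * Δ ys) ,
    solve 5 (λ ab ba pa pb δ → (ab :* pa) :* (pb :* δ) := (pa :* (pb :* δ)) :* ab) refl
      (t * a + b) (t * b + a) (factors a ys) (factors b ys) (Δ ys) ,
    solve 5 (λ ab ba pa pb δ → (ba :* pb) :* (pa :* δ) := (pa :* (pb :* δ)) :* ba) refl
      (t * a + b) (t * b + a) (factors a ys) (factors b ys) (Δ ys)
  Δ-exchange (x ∷ xs) a b ys with Δ-exchange xs a b ys
  ... | Q , ab , ba = factors x (xs ++ a ∷ b ∷ ys) * Q ,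
    trans (*-congˡ ab) (sym (*-assoc _ _ _)) ,
    trans (*-cong (sym (factors-exchange x xs a b ys)) ba) (sym (*-assoc _ _ _))

  deltaFactor≈Δ : ∀ {m} (z : Fin m → Carrier) → deltaFactor t z ≈ Δ (tabulate z)
  deltaFactor≈Δ {zero} z = refl
  deltaFactor≈Δ {suc m} z = begin
    deltaFactor t z
      ≈⟨ reflexive (prod-allFin-suc (row z)) ⟩
    row z zero * prodR (allFin m) (row z ∘ suc)
      ≈⟨ *-cong (prod-one (allFin (suc m))) (prod-cong (allFin m) (λ i → reflexive (prod-allFin-suc (entry z (suc i))))) ⟩
    1# * prodR (allFin m) (λ i → (t * z zero + z (suc i)) * row (z ∘ suc) i)
      ≈⟨ *-identityˡ _ ⟩
    prodR (allFin m) (λ i → (t * z zero + z (suc i)) * row (z ∘ suc) i)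
      ≈⟨ prod-* (allFin m) (λ i → t * z zero + z (suc i)) (row (z ∘ suc)) ⟩
    prodR (allFin m) (λ i → t * z zero + z (suc i)) * deltaFactor t (z ∘ suc)
      ≈⟨ *-cong (reflexive (≡.sym (foldr-tabulate (λ y p → (t * z zero + y) * p) 1# (z ∘ suc)))) (deltaFactor≈Δ (z ∘ suc)) ⟩
    Δ (tabulate z) ∎
    where
      entry : ∀ {k} → (Fin k → Carrier) → Fin k → Fin k → Carrier
      entry w i j = if toℕ j ℕ.<ᵇ toℕ i then t * w j + w i else 1#
      row : ∀ {k} → (Fin k → Carrier) → Fin k → Carrier
      row {k} w i = prodR (allFin k) (entry w i)

module Stacks {c ℓ} (R : CommutativeRing c ℓ) (t : CommutativeRing.Carrier R) (K : ℕ) (α : ℕ → CommutativeRing.Carrier R) where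
  open CommutativeRing R hiding (zero)
  open SixVertex R using (sumR)
  open FiniteSums R
  open Rows R t
  open DeltaFactor R t
  open import Algebra.Properties.CommutativeSemigroup *-commutativeSemigroup using (x∙yz≈y∙xz)
  open import Relation.Binary.Reasoning.Setoid setoid

  allPlus : Config K → Bool
  allPlus a = all (λ j → isPlus (a j)) (allFin K)

  configs : List (Config K)
  configs = allFuns spins K

  stack : List Carrier → Config K → Carrier
  stack [] a = when (allPlus a) 1#
  stack (x ∷ zs) a = sumR configs (λ b → row K x α minus a b * stack zs b)

  stack-resp : ∀ zs {a a′} → a ≗ a′ → stack zs a ≈ stack zs a′
  stack-resp [] a≗a′ = reflexive (≡.cong (λ b → when b 1#) (all-cong (allFin K) (λ j → ≡.cong isPlus (a≗a′ j))))
  stack-resp (x ∷ zs) a≗a′ = sum-cong configs (λ b → *-congʳ (row-resp K x α minus b a≗a′))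

  stack-twoRows : ∀ x y zs a → stack (x ∷ y ∷ zs) a ≈ sumR configs (λ d → twoRows K x y α minus minus a d * stack zs d)
  stack-twoRows x y zs a = sum-assoc configs configs (row K x α minus a) (row K y α minus) (stack zs)

  stack-exchange : ∀ x y zs a → (t * x + y) * stack (x ∷ y ∷ zs) a ≈ (t * y + x) * stack (y ∷ x ∷ zs) a
  stack-exchange x y zs a = begin
    (t * x + y) * stack (x ∷ y ∷ zs) a
      ≈⟨ *-congˡ (stack-twoRows x y zs a) ⟩
    (t * x + y) * sumR configs (λ d → twoRows K x y α minus minus a d * stack zs d)
      ≈⟨ *-sum configs (t * x + y) _ ⟩
    sumR configs (λ d → (t * x + y) * (twoRows K x y α minus minus a d * stack zs d))
      ≈⟨ sum-cong configs (λ d → trans (sym (*-assoc _ _ (stack zs d)))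
           (trans (*-congʳ (row-exchange K x y α a d)) (*-assoc _ _ (stack zs d)))) ⟩
    sumR configs (λ d → (t * y + x) * (twoRows K y x α minus minus a d * stack zs d))
      ≈⟨ *-sum configs (t * y + x) _ ⟨
    (t * y + x) * sumR configs (λ d → twoRows K y x α minus minus a d * stack zs d)
      ≈⟨ *-congˡ (stack-twoRows y x zs a) ⟨
    (t * y + x) * stack (y ∷ x ∷ zs) a ∎

  stack-exchange-below : ∀ xs r₁ r₂ l₁ l₂ → (∀ d → r₁ * stack l₁ d ≈ r₂ * stack l₂ d) →
    ∀ a → r₁ * stack (xs ++ l₁) a ≈ r₂ * stack (xs ++ l₂) a
  stack-exchange-below [] r₁ r₂ l₁ l₂ same a = same a
  stack-exchange-below (x ∷ xs) r₁ r₂ l₁ l₂ same a = begin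
    r₁ * sumR configs (λ b → row K x α minus a b * stack (xs ++ l₁) b)
      ≈⟨ *-sum configs r₁ _ ⟩
    sumR configs (λ b → r₁ * (row K x α minus a b * stack (xs ++ l₁) b))
      ≈⟨ sum-cong configs (λ b → trans (x∙yz≈y∙xz r₁ _ _)
           (trans (*-congˡ (stack-exchange-below xs r₁ r₂ l₁ l₂ same b)) (x∙yz≈y∙xz _ r₂ _))) ⟩
    sumR configs (λ b → r₂ * (row K x α minus a b * stack (xs ++ l₂) b))
      ≈⟨ *-sum configs r₂ _ ⟨
    r₂ * sumR configs (λ b → row K x α minus a b * stack (xs ++ l₂) b) ∎

  symmetrised : Config K → List Carrier → Carrier
  symmetrised a zs = Δ zs * stack zs a

  symmetrised-exchange : ∀ a xs x y ys → symmetrised a (xs ++ x ∷ y ∷ ys) ≈ symmetrised a (xs ++ y ∷ x ∷ ys)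
  symmetrised-exchange a xs x y ys with Δ-exchange xs x y ys
  ... | Q , xy , yx = begin
    Δ (xs ++ x ∷ y ∷ ys) * stack (xs ++ x ∷ y ∷ ys) a    ≈⟨ *-congʳ xy ⟩
    Q * (t * x + y) * stack (xs ++ x ∷ y ∷ ys) a         ≈⟨ *-assoc _ _ _ ⟩
    Q * ((t * x + y) * stack (xs ++ x ∷ y ∷ ys) a)
      ≈⟨ *-congˡ (stack-exchange-below xs _ _ (x ∷ y ∷ ys) (y ∷ x ∷ ys) (stack-exchange x y ys) a) ⟩
    Q * ((t * y + x) * stack (xs ++ y ∷ x ∷ ys) a)       ≈⟨ *-assoc _ _ _ ⟨
    Q * (t * y + x) * stack (xs ++ y ∷ x ∷ ys) a         ≈⟨ *-congʳ yx ⟨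
    Δ (xs ++ y ∷ x ∷ ys) * stack (xs ++ y ∷ x ∷ ys) a    ∎

  symmetrised-↭ : ∀ a {zs zs′} → zs ↭ zs′ → symmetrised a zs ≈ symmetrised a zs′
  symmetrised-↭ a = AdjacentSwaps.↭-invariant setoid (symmetrised a) (symmetrised-exchange a)

module RowStates {c ℓ} (R : CommutativeRing c ℓ) (t : CommutativeRing.Carrier R) where
  open CommutativeRing R hiding (zero)
  open SixVertex R using (vweight; sumR; prodR)
  open FiniteSums R
  open Rows R t
  open import Relation.Binary.Reasoning.Setoid setoid

  -- The weight of a row whose horizontal edges carry the spins h, from
  -- h zero at the right boundary to h k at the left boundary.
  rowWeight : (k : ℕ) → Carrier → (ℕ → Carrier) → (Fin (suc k) → Spin) → Config k → Config k → Carrier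
  rowWeight k x β h a b = prodR (allFin k) (λ j → vweight t x (β (suc (toℕ j))) (h (suc j)) (a j) (h (inject₁ j)) (b j))

  flatRow : (k : ℕ) → Carrier → (ℕ → Carrier) → Spin → Config k → Config k → Carrier
  flatRow k x β s a b = sumR (allFuns spins (suc k)) (λ h → when (h zero =ˢ s ∧ isPlus (h (fromℕ k))) (rowWeight k x β h a b))

  flatRow≈row : ∀ k x β s a b → flatRow k x β s a b ≈ row k x β s a b
  flatRow≈row zero x β plus a b = trans (+-congˡ (+-identityˡ 0#)) (+-identityʳ 1#)
  flatRow≈row zero x β minus a b = trans (+-identityˡ _) (+-identityˡ 0#)
  flatRow≈row (suc k) x β s a b = begin
    flatRow (suc k) x β s a b
      ≈⟨ sum-allFuns-suc spins (suc k) _ (λ s₀ h → when (s₀ =ˢ s) (body s₀ h)) split ⟩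
    sumR spins (λ s₀ → sumR hs (λ h → when (s₀ =ˢ s) (body s₀ h)))
      ≈⟨ sum-cong spins (λ s₀ → sum-when hs (s₀ =ˢ s) (body s₀)) ⟩
    sumR spins (λ s₀ → when (s₀ =ˢ s) (sumR hs (body s₀)))
      ≈⟨ sum-select s (λ s₀ → sumR hs (body s₀)) ⟩
    sumR hs (body s)
      ≈⟨ sum-cong hs (λ h → trans (sym (*-when (W (h zero) s) (leftPlus h) (rw h))) (sym (sum-select′ (h zero) (moved h)))) ⟩
    sumR hs (λ h → sumR spins (λ s′ → when (h zero =ˢ s′) (moved h s′)))
      ≈⟨ sum-swap hs spins (λ h s′ → when (h zero =ˢ s′) (moved h s′)) ⟩
    sumR spins (λ s′ → sumR hs (λ h → when (h zero =ˢ s′) (moved h s′)))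
      ≈⟨ sum-cong spins (λ s′ → trans (sum-cong hs (λ h → sym (*-when (W s′ s) (h zero =ˢ s′) (when (leftPlus h) (rw h)))))
                                      (sym (*-sum hs (W s′ s) (λ h → when (h zero =ˢ s′) (when (leftPlus h) (rw h)))))) ⟩
    sumR spins (λ s′ → W s′ s * sumR hs (λ h → when (h zero =ˢ s′) (when (leftPlus h) (rw h))))
      ≈⟨ sum-cong spins (λ s′ → *-congˡ {W s′ s} (trans (sum-cong hs (λ h → reflexive (≡.sym (when-∧ (h zero =ˢ s′) (leftPlus h) (rw h)))))
                                               (flatRow≈row k x (β ∘ suc) s′ (a ∘ suc) (b ∘ suc)))) ⟩
    row (suc k) x β s a b ∎
    where
      hs : List (Fin (suc k) → Spin)
      hs = allFuns spins (suc k)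
      leftPlus : (Fin (suc k) → Spin) → Bool
      leftPlus h = isPlus (h (fromℕ k))
      W : Spin → Spin → Carrier
      W l r = vweight t x (β 1) l (a zero) r (b zero)
      rw : (Fin (suc k) → Spin) → Carrier
      rw h = rowWeight k x (β ∘ suc) h (a ∘ suc) (b ∘ suc)
      body : Spin → (Fin (suc k) → Spin) → Carrier
      body s₀ h = when (leftPlus h) (W (h zero) s₀ * rw h)
      moved : (Fin (suc k) → Spin) → Spin → Carrier
      moved h s′ = W s′ s * when (leftPlus h) (rw h)
      split : ∀ h → when (h zero =ˢ s ∧ isPlus (h (fromℕ (suc k)))) (rowWeight (suc k) x β h a b)
                    ≈ when (h zero =ˢ s) (when (leftPlus (h ∘ suc)) (W (h (suc zero)) (h zero) * rw (h ∘ suc)))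
      split h = reflexive (≡.trans (when-∧ (h zero =ˢ s) _ _)
                  (≡.cong (λ w → when (h zero =ˢ s) (when (leftPlus (h ∘ suc)) w))
                    (prod-allFin-suc (λ j → vweight t x (β (suc (toℕ j))) (h (suc j)) (a j) (h (inject₁ j)) (b j)))))

module Lattice {c ℓ} (R : CommutativeRing c ℓ) (t : CommutativeRing.Carrier R) (K : ℕ) (α : ℕ → CommutativeRing.Carrier R) where
  open CommutativeRing R hiding (zero)
  open SixVertex R using (sumR; prodR)
  open FiniteSums R
  open Rows R t
  open RowStates R t
  open Stacks R t K α
  open import Relation.Binary.Reasoning.Setoid setoid

  RowState : Set
  RowState = Fin (suc K) → Spin

  rowStates : List RowState
  rowStates = allFuns spins (suc K)

  rowOK : RowState → Bool
  rowOK h = isPlus (h (fromℕ K)) ∧ isMinus (h zero)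

  rowSum : Carrier → Config K → Config K → Carrier
  rowSum x a b = sumR rowStates (λ h → when (rowOK h) (rowWeight K x α h a b))

  rowSum≈row : ∀ x a b → rowSum x a b ≈ row K x α minus a b
  rowSum≈row x a b = trans
    (sum-cong rowStates (λ h → reflexive (≡.cong (λ ok → when ok (rowWeight K x α h a b)) (∧-comm (isPlus (h (fromℕ K))) (isMinus (h zero))))))
    (flatRow≈row K x α minus a b)

  lattice : (n : ℕ) → (Fin n → Carrier) → (Fin (suc n) → Config K) → Carrier
  lattice n z v = sumR (allFuns rowStates n) (λ hs → when (rowsOK hs ∧ allPlus (v (fromℕ n))) (weight hs))
    where
      rowsOK : (Fin n → RowState) → Bool
      rowsOK hs = all (λ i → rowOK (hs i)) (allFin n)
      weight : (Fin n → RowState) → Carrier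
      weight hs = prodR (allFin n) (λ i → rowWeight K (z i) α (hs i) (v (inject₁ i)) (v (suc i)))

  lattice-step : ∀ m z v → lattice (suc m) z v ≈ rowSum (z zero) (v zero) (v (suc zero)) * lattice m (z ∘ suc) (v ∘ suc)
  lattice-step m z v =
    trans (sum-allFuns-suc rowStates m _ (λ h hs → top h * bottom hs) split)
          (sym (sum-product rowStates (allFuns rowStates m) top bottom))
    where
      top : RowState → Carrier
      top h = when (rowOK h) (rowWeight K (z zero) α h (v zero) (v (suc zero)))
      rowsOK : (Fin m → RowState) → Bool
      rowsOK hs = all (λ i → rowOK (hs i)) (allFin m)
      weight : (Fin m → RowState) → Carrier
      weight hs = prodR (allFin m) (λ i → rowWeight K (z (suc i)) α (hs i) (v (suc (inject₁ i))) (v (suc (suc i))))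
      bottom : (Fin m → RowState) → Carrier
      bottom hs = when (rowsOK hs ∧ allPlus (v (suc (fromℕ m)))) (weight hs)
      split : ∀ (hs : Fin (suc m) → RowState) →
        when (all (λ i → rowOK (hs i)) (allFin (suc m)) ∧ allPlus (v (fromℕ (suc m))))
             (prodR (allFin (suc m)) (λ i → rowWeight K (z i) α (hs i) (v (inject₁ i)) (v (suc i))))
        ≈ top (hs zero) * bottom (hs ∘ suc)
      split hs = trans (reflexive (≡.cong₂ when
          (≡.trans (≡.cong (_∧ allPlus (v (fromℕ (suc m)))) (all-allFin-suc (λ i → rowOK (hs i))))
                   (∧-assoc (rowOK (hs zero)) (rowsOK (hs ∘ suc)) _))
          (prod-allFin-suc (λ i → rowWeight K (z i) α (hs i) (v (inject₁ i)) (v (suc i))))))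
        (when-∧-* (rowOK (hs zero)) _ _ _)

  stack-from-lattice : ∀ n (z : Fin n → Carrier) (Ψ : Config K → Carrier) →
    sumR (allFuns configs (suc n)) (λ v → Ψ (v zero) * lattice n z v) ≈ sumR configs (λ v₀ → Ψ v₀ * stack (tabulate z) v₀)
  stack-from-lattice zero z Ψ =
    trans (sum-allFuns-suc configs 0 _ (λ v₀ _ → Ψ v₀ * when (allPlus v₀) 1#) (λ v → *-congˡ (+-identityʳ _)))
          (sum-cong configs (λ v₀ → +-identityʳ _))
  stack-from-lattice (suc m) z Ψ = begin
    sumR (allFuns configs (suc (suc m))) (λ v → Ψ (v zero) * lattice (suc m) z v)
      ≈⟨ sum-allFuns-suc configs (suc m) _ (λ v₀ v → (Ψ v₀ * rowSum (z zero) v₀ (v zero)) * lattice m (z ∘ suc) v)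
           (λ v → trans (*-congˡ (lattice-step m z v)) (sym (*-assoc _ _ _))) ⟩
    sumR configs (λ v₀ → sumR (allFuns configs (suc m)) (λ v → (Ψ v₀ * rowSum (z zero) v₀ (v zero)) * lattice m (z ∘ suc) v))
      ≈⟨ sum-cong configs (λ v₀ → stack-from-lattice m (z ∘ suc) (λ v₁ → Ψ v₀ * rowSum (z zero) v₀ v₁)) ⟩
    sumR configs (λ v₀ → sumR configs (λ v₁ → (Ψ v₀ * rowSum (z zero) v₀ v₁) * stack (tabulate (z ∘ suc)) v₁))
      ≈⟨ sum-cong configs (λ v₀ → trans
           (sum-cong configs (λ v₁ → trans (*-assoc _ _ _) (*-congˡ (*-congʳ (rowSum≈row (z zero) v₀ v₁)))))
           (sym (*-sum configs (Ψ v₀) _))) ⟩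
    sumR configs (λ v₀ → Ψ v₀ * stack (tabulate z) v₀) ∎

module PartitionFunction {c ℓ} (R : CommutativeRing c ℓ) {n : ℕ} (lam : Vec ℕ n)
    (t : CommutativeRing.Carrier R) (α : ℕ → CommutativeRing.Carrier R) where
  open CommutativeRing R hiding (zero)
  open SixVertex R
  open FiniteSums R
  open Rows R t
  open Stacks R t (numCols lam) α
  open Lattice R t (numCols lam) α
  open import Relation.Binary.Reasoning.Setoid setoid

  top : Config (numCols lam)
  top j = if inLamRho lam (suc (toℕ j)) then minus else plus

  topOK : Config (numCols lam) → Bool
  topOK u = all (λ j → u j =ˢ top j) (allFin (numCols lam))

  boundary-split : ∀ (h : Fin n → RowState) (v : Fin (suc n) → Config (numCols lam)) W →
    when (boundaryOK lam h v) W ≈ when (topOK (v zero)) 1# * when (all (λ i → rowOK (h i)) (allFin n) ∧ allPlus (v (fromℕ n))) W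
  boundary-split h v W = trans (reflexive (≡.cong (λ ok → when ok W) conditions))
    (trans (when-cong (topOK (v zero) ∧ _) (sym (*-identityˡ W))) (when-∧-* (topOK (v zero)) _ 1# W))
    where
      rowsOK : Bool
      rowsOK = all (λ i → rowOK (h i)) (allFin n)
      topCondition : ∀ b s → (if b then isMinus s else isPlus s) ≡.≡ s =ˢ (if b then minus else plus)
      topCondition false s = ≡.refl
      topCondition true s = ≡.refl
      conditions : boundaryOK lam h v ≡.≡ topOK (v zero) ∧ (rowsOK ∧ allPlus (v (fromℕ n)))
      conditions = ≡.trans
        (≡.cong (rowsOK ∧_) (≡.trans (all-∧ (allFin (numCols lam)) _ _)
          (≡.cong (allPlus (v (fromℕ n)) ∧_) (all-cong (allFin (numCols lam)) (λ j → topCondition (inLamRho lam (suc (toℕ j))) (v zero j))))))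
        (≡.trans (≡.sym (∧-assoc rowsOK _ _)) (∧-comm _ (topOK (v zero))))

  Z≈stack : ∀ z → Z lam t α z ≈ stack (tabulate z) top
  Z≈stack z = begin
    Z lam t α z
      ≈⟨ sum-cong (allFuns rowStates n) (λ h → sum-cong (allFuns configs (suc n)) (λ v → boundary-split h v (stateWeight lam t α z h v))) ⟩
    sumR (allFuns rowStates n) (λ h → sumR (allFuns configs (suc n)) (λ v → Ψ (v zero) * inner h v))
      ≈⟨ sum-swap (allFuns rowStates n) (allFuns configs (suc n)) _ ⟩
    sumR (allFuns configs (suc n)) (λ v → sumR (allFuns rowStates n) (λ h → Ψ (v zero) * inner h v))
      ≈⟨ sum-cong (allFuns configs (suc n)) (λ v → sym (*-sum (allFuns rowStates n) (Ψ (v zero)) (λ h → inner h v))) ⟩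
    sumR (allFuns configs (suc n)) (λ v → Ψ (v zero) * lattice n z v)
      ≈⟨ stack-from-lattice n z Ψ ⟩
    sumR configs (λ v₀ → Ψ v₀ * stack (tabulate z) v₀)
      ≈⟨ sum-point-mass (numCols lam) top (stack (tabulate z)) (stack-resp (tabulate z)) ⟩
    stack (tabulate z) top ∎
    where
      Ψ : Config (numCols lam) → Carrier
      Ψ u = when (topOK u) 1#
      inner : (Fin n → RowState) → (Fin (suc n) → Config (numCols lam)) → Carrier
      inner h v = when (all (λ i → rowOK (h i)) (allFin n) ∧ allPlus (v (fromℕ n))) (stateWeight lam t α z h v)

mainTheorem5 : ∀ {c ℓ : Level} (R : CommutativeRing c ℓ) (n : ℕ) → 1 ≤ n →
    (lam : Vec ℕ n) → IsPartition lam →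
    (t : CommutativeRing.Carrier R) (α : ℕ → CommutativeRing.Carrier R)
    (z : Fin n → CommutativeRing.Carrier R) (σ : Permutation′ n) →
    CommutativeRing._≈_ R
      (CommutativeRing._*_ R (SixVertex.deltaFactor R t (λ i → z (σ ⟨$⟩ʳ i)))
        (SixVertex.Z R lam t α (λ i → z (σ ⟨$⟩ʳ i))))
      (CommutativeRing._*_ R (SixVertex.deltaFactor R t z) (SixVertex.Z R lam t α z))
mainTheorem5 R n _ lam _ t α z σ = begin
  deltaFactor t zσ * Z lam t α zσ                        ≈⟨ *-cong (deltaFactor≈Δ zσ) (Z≈stack zσ) ⟩
  symmetrised top (tabulate zσ)                         ≈⟨ symmetrised-↭ top (tabulate-↭ σ z) ⟩
  symmetrised top (tabulate z)                          ≈⟨ *-cong (deltaFactor≈Δ z) (Z≈stack z) ⟨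
  deltaFactor t z * Z lam t α z                          ∎
  where
    open CommutativeRing R
    open SixVertex R using (deltaFactor; Z)
    open DeltaFactor R t using (deltaFactor≈Δ)
    open Stacks R t (numCols lam) α using (symmetrised; symmetrised-↭)
    open PartitionFunction R lam t α using (top; Z≈stack)
    open import Relation.Binary.Reasoning.Setoid setoid
    zσ : Fin n → Carrier
    zσ i = z (σ ⟨$⟩ʳ i)
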